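{- Let $F:\mathbb{N}^+\times\mathbb{N}^+\to\mathbb{N}^+$ be defined by $$F(m,n)=\frac{1}{4}\left[(m+n-1)^2-\big((m+n-1)\bmod 2\big)\right]+\min(m,n).$$ For every $C\in\mathbb{N}^+$, the equation $F(m,n)=C$ has exactly one solution $(m,n)\in\mathbb{N}^+\times\mathbb{N}^+$ with $m\ge n$. Namely, letting $t=\lfloor\sqrt{C}\rfloor$, $a=\operatorname{sgn}(C-t^2)$ and $b=\operatorname{sgn}'(C-t^2-t)$, this solution is $$m=(1-a)t+a\big[(t+1)(t+1+b)-C\big],\qquad n=(1-a)t+a\big[C-t(t+b)\big].$$
   Context: $\mathbb{N}^+$ denotes the set of positive integers. For an integer $k$, $k\bmod 2$ denotes the least non-negative residue of $k$ modulo $2$. $\operatorname{sgn}$ is the usual signum function, and $\operatorname{sgn}'(x)=\frac{\operatorname{sgn}^2(x)+\operatorname{sgn}(x)}{2}$, i.e. $\operatorname{sgn}'(x)=0$ if $x\le 0$ and $\operatorname{sgn}'(x)=1$ if $x>0$. -}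

module Defs where

open import Data.Nat as ℕ using (ℕ; zero; suc; _⊓_; _∸_; _%_; _/_)
open import Data.Integer as ℤ using (ℤ; +_; 0ℤ; 1ℤ)
open import Data.Integer.DivMod as ℤD using ()

-- F(m,n) = ((m+n-1)^2 - ((m+n-1) mod 2)) / 4 + min(m,n)
-- (the bracket is always divisible by 4, so ℕ division is exact here)
F : ℕ → ℕ → ℕ
F m n = let s = m ℕ.+ n ∸ 1 in (s ℕ.* s ∸ s % 2) / 4 ℕ.+ (m ⊓ n)

sgn : ℤ → ℤ
sgn (+ zero)    = 0ℤ
sgn (+ suc _)   = 1ℤ
sgn ℤ.-[1+ _ ]  = ℤ.- 1ℤ

sgn' : ℤ → ℤ
sgn' x = ((sgn x ℤ.* sgn x) ℤ.+ sgn x) ℤD./ (+ 2)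

aOf : ℕ → ℕ → ℤ
aOf C t = sgn (+ C ℤ.- + (t ℕ.* t))

bOf : ℕ → ℕ → ℤ
bOf C t = sgn' (+ C ℤ.- + (t ℕ.* t) ℤ.- + t)

mSol : ℕ → ℕ → ℤ
mSol C t = let a = aOf C t ; b = bOf C t ; T = + t in
  (1ℤ ℤ.- a) ℤ.* T ℤ.+ a ℤ.* ((T ℤ.+ 1ℤ) ℤ.* (T ℤ.+ 1ℤ ℤ.+ b) ℤ.- + C)

nSol : ℕ → ℕ → ℤ
nSol C t = let a = aOf C t ; b = bOf C t ; T = + t in
  (1ℤ ℤ.- a) ℤ.* T ℤ.+ a ℤ.* (+ C ℤ.- T ℤ.* (T ℤ.+ b))

-- Write m = n + d with n ≥ 1.  If d = 2w + 1 then F(m,n) = k² + n with k = n + w ≥ n; if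
-- d = 2w then F(m,n) = k² + k + n with k = n + w − 1 ≥ n − 1.  Hence C = t² + r with
-- t = ⌊√C⌋ and 0 ≤ r ≤ 2t is attained exactly by: m = n = t when r = 0 (d = 0); n = r with
-- d odd when 1 ≤ r ≤ t; n = r − t with d even and positive when r > t.  In every case the
-- closed form evaluates to (m, n), i.e. it is a left inverse of F on {1 ≤ n ≤ m}, which
-- gives uniqueness.

module Submission where

open import Defs
open import Data.Nat using (ℕ; suc; _*_; _≤_; _<_)
open import Data.Integer using (+_)
open import Data.Product using (Σ; _×_)
open import Relation.Binary.PropositionalEquality using (_≡_)

open import Data.Nat using (zero; _+_; _∸_; _%_; _/_; z≤n; s≤s; _≤?_)
open import Data.Nat.Properties
open import Data.Nat.DivMod using (m*n%n≡0; [m+kn]%n≡m%n; m*n/n≡m)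
open import Data.Nat.Tactic.RingSolver as ℕ-Solver using ()
open import Data.Integer as ℤ using (ℤ; 0ℤ; 1ℤ; _⊖_)
open import Data.Integer.Properties as ℤ using (pos-+; pos-*; m-n≡m⊖n; ⊖-≥; ⊖-≤)
open import Data.Integer.Tactic.RingSolver as ℤ-Solver using ()
open import Data.Product using (_,_; ∃₂; proj₁; proj₂)
open import Data.Empty using (⊥-elim)
open import Relation.Nullary using (yes; no)
open import Relation.Binary.Definitions using (tri<; tri≈; tri>)
open import Relation.Binary.PropositionalEquality
  using (refl; sym; trans; cong; cong₂; subst; module ≡-Reasoning)
open ≡-Reasoning

data Parity : ℕ → Set where
  even : ∀ w → Parity (w + w)
  odd  : ∀ w → Parity (suc (w + w))

parity : ∀ d → Parity d
parity zero = even 0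
parity (suc d) with parity d
... | even w = odd w
... | odd w = subst Parity (cong suc (+-suc w w)) (even (suc w))

quarter-square : ℕ → ℕ
quarter-square s = (s * s ∸ s % 2) / 4

quarter-square-even : ∀ k → quarter-square (k * 2) ≡ k * k
quarter-square-even k = begin
  ((k * 2) * (k * 2) ∸ (k * 2) % 2) / 4  ≡⟨ cong (λ r → ((k * 2) * (k * 2) ∸ r) / 4) (m*n%n≡0 k 2) ⟩
  ((k * 2) * (k * 2)) / 4                ≡⟨ cong (_/ 4) (square-double k) ⟩
  (k * k) * 4 / 4                        ≡⟨ m*n/n≡m (k * k) 4 ⟩
  k * k                                  ∎
  where
  square-double : ∀ k → (k * 2) * (k * 2) ≡ (k * k) * 4
  square-double = ℕ-Solver.solve-∀

quarter-square-odd : ∀ k → quarter-square (1 + k * 2) ≡ k * k + k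
quarter-square-odd k = begin
  (s * s ∸ s % 2) / 4    ≡⟨ cong (λ r → (s * s ∸ r) / 4) ([m+kn]%n≡m%n 1 k 2) ⟩
  (s * s ∸ 1) / 4        ≡⟨ cong (λ x → (x ∸ 1) / 4) (square-odd k) ⟩
  (k * k + k) * 4 / 4    ≡⟨ m*n/n≡m (k * k + k) 4 ⟩
  k * k + k              ∎
  where
  s = 1 + k * 2
  square-odd : ∀ k → (1 + k * 2) * (1 + k * 2) ≡ 1 + (k * k + k) * 4
  square-odd = ℕ-Solver.solve-∀

F-via-quarter-square : ∀ {m n s} → m + n ∸ 1 ≡ s → n ≤ m → F m n ≡ quarter-square s + n
F-via-quarter-square m+n∸1≡s n≤m =
  cong₂ (λ s k → quarter-square s + k) m+n∸1≡s (m≥n⇒m⊓n≡n n≤m)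

F-odd-gap : ∀ n w → F (n + suc (w + w)) n ≡ (n + w) * (n + w) + n
F-odd-gap n w = begin
  F (n + suc (w + w)) n              ≡⟨ F-via-quarter-square (cong (_∸ 1) (sum≡ n w)) (m≤m+n n _) ⟩
  quarter-square ((n + w) * 2) + n   ≡⟨ cong (_+ n) (quarter-square-even (n + w)) ⟩
  (n + w) * (n + w) + n              ∎
  where
  sum≡ : ∀ n w → n + suc (w + w) + n ≡ suc ((n + w) * 2)
  sum≡ = ℕ-Solver.solve-∀

F-even-gap : ∀ p w → F (suc p + (w + w)) (suc p) ≡ (p + w) * (p + w) + ((p + w) + suc p)
F-even-gap p w = begin
  F (suc p + (w + w)) (suc p)                ≡⟨ F-via-quarter-square (cong (_∸ 1) (sum≡ p w)) (m≤m+n (suc p) _) ⟩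
  quarter-square (1 + (p + w) * 2) + suc p   ≡⟨ cong (_+ suc p) (quarter-square-odd (p + w)) ⟩
  (p + w) * (p + w) + (p + w) + suc p        ≡⟨ +-assoc ((p + w) * (p + w)) (p + w) (suc p) ⟩
  (p + w) * (p + w) + ((p + w) + suc p)      ∎
  where
  sum≡ : ∀ p w → suc p + (w + w) + suc p ≡ suc (1 + (p + w) * 2)
  sum≡ = ℕ-Solver.solve-∀

F-diagonal : ∀ n → F n n ≡ n * n
F-diagonal zero = refl
F-diagonal (suc p) = begin
  F (suc p) (suc p)                  ≡⟨ cong (λ m → F m (suc p)) (sym (+-identityʳ (suc p))) ⟩
  F (suc p + (0 + 0)) (suc p)        ≡⟨ F-even-gap p 0 ⟩
  (p + 0) * (p + 0) + ((p + 0) + suc p) ≡⟨ expand p ⟩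
  suc p * suc p                      ∎
  where
  expand : ∀ p → (p + 0) * (p + 0) + ((p + 0) + suc p) ≡ suc p * suc p
  expand = ℕ-Solver.solve-∀

square-suc : ∀ k → suc k * suc k ≡ suc (k * k + (k + k))
square-suc = ℕ-Solver.solve-∀

record IsFloorSqrt (t C : ℕ) : Set where
  constructor isFloorSqrt
  field
    lower : t * t ≤ C
    upper : C < suc t * suc t

floorSqrt-unique : ∀ {s t C} → IsFloorSqrt s C → IsFloorSqrt t C → s ≡ t
floorSqrt-unique {s} {t} (isFloorSqrt s²≤C C<[s+1]²) (isFloorSqrt t²≤C C<[t+1]²) with <-cmp s t
... | tri≈ _ s≡t _ = s≡t
... | tri< s<t _ _ = ⊥-elim (<-irrefl refl (<-≤-trans C<[s+1]² (≤-trans (*-mono-≤ s<t s<t) t²≤C)))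
... | tri> _ _ t<s = ⊥-elim (<-irrefl refl (<-≤-trans C<[t+1]² (≤-trans (*-mono-≤ t<s t<s) s²≤C)))

floorSqrt-square+ : ∀ {k r} → r ≤ k + k → IsFloorSqrt k (k * k + r)
floorSqrt-square+ {k} {r} r≤2k =
  isFloorSqrt (m≤m+n (k * k) r) (subst (k * k + r <_) (sym (square-suc k)) (s≤s (+-monoʳ-≤ (k * k) r≤2k)))

floorSqrt-excess-≤ : ∀ {t r} → IsFloorSqrt t (t * t + r) → r ≤ t + t
floorSqrt-excess-≤ {t} {r} (isFloorSqrt _ C<[t+1]²) =
  +-cancelˡ-≤ (t * t) r (t + t) (≤-pred (subst (t * t + r <_) (square-suc t) C<[t+1]²))

floorSqrt-square : ∀ n → IsFloorSqrt n (n * n)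
floorSqrt-square n = subst (IsFloorSqrt n) (+-identityʳ (n * n)) (floorSqrt-square+ z≤n)

floorSqrt-odd-gap : ∀ n w → IsFloorSqrt (n + w) ((n + w) * (n + w) + n)
floorSqrt-odd-gap n w = floorSqrt-square+ (≤-trans (m≤m+n n w) (m≤m+n (n + w) (n + w)))

floorSqrt-even-gap : ∀ p v → let k = p + suc v in IsFloorSqrt k (k * k + (k + suc p))
floorSqrt-even-gap p v =
  floorSqrt-square+ (+-monoʳ-≤ (p + suc v) (≤-trans (s≤s (m≤m+n p v)) (≤-reflexive (sym (+-suc p v)))))

sgn-positive : ∀ {x} → 0 < x → sgn (+ x) ≡ 1ℤ
sgn-positive (s≤s z≤n) = refl

sgn'-nonpositive : ∀ x → sgn' (ℤ.- + x) ≡ 0ℤ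
sgn'-nonpositive zero    = refl
sgn'-nonpositive (suc _) = refl

sgn[m⊖n]≡1 : ∀ {m n} → n < m → sgn (m ⊖ n) ≡ 1ℤ
sgn[m⊖n]≡1 n<m = trans (cong sgn (⊖-≥ (<⇒≤ n<m))) (sgn-positive (m<n⇒0<n∸m n<m))

sgn'[m⊖n]≡1 : ∀ {m n} → n < m → sgn' (m ⊖ n) ≡ 1ℤ
sgn'[m⊖n]≡1 n<m = cong (λ s → (s ℤ.* s ℤ.+ s) ℤ./ + 2) (sgn[m⊖n]≡1 n<m)

sgn'[m⊖n]≡0 : ∀ {m n} → m ≤ n → sgn' (m ⊖ n) ≡ 0ℤ
sgn'[m⊖n]≡0 {m} {n} m≤n = trans (cong sgn' (⊖-≤ m≤n)) (sgn'-nonpositive (n ∸ m))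

aOf-square : ∀ t → aOf (t * t) t ≡ 0ℤ
aOf-square t = cong sgn (ℤ.+-inverseʳ (+ (t * t)))

aOf≡1 : ∀ {C t} → t * t < C → aOf C t ≡ 1ℤ
aOf≡1 {C} {t} t²<C = trans (cong sgn (m-n≡m⊖n C (t * t))) (sgn[m⊖n]≡1 t²<C)

bOf-as-⊖ : ∀ C t → bOf C t ≡ sgn' (C ⊖ (t * t + t))
bOf-as-⊖ C t = cong sgn' (begin
  + C ℤ.- + (t * t) ℤ.- + t        ≡⟨ minus-minus (+ C) (+ (t * t)) (+ t) ⟩
  + C ℤ.- (+ (t * t) ℤ.+ + t)      ≡⟨ cong (λ x → + C ℤ.- x) (sym (pos-+ (t * t) t)) ⟩
  + C ℤ.- + (t * t + t)            ≡⟨ m-n≡m⊖n C (t * t + t) ⟩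
  C ⊖ (t * t + t)                  ∎)
  where
  minus-minus : ∀ c x y → c ℤ.- x ℤ.- y ≡ c ℤ.- (x ℤ.+ y)
  minus-minus = ℤ-Solver.solve-∀

bOf≡0 : ∀ {C t} → C ≤ t * t + t → bOf C t ≡ 0ℤ
bOf≡0 {C} {t} C≤t²+t = trans (bOf-as-⊖ C t) (sgn'[m⊖n]≡0 C≤t²+t)

bOf≡1 : ∀ {C t} → t * t + t < C → bOf C t ≡ 1ℤ
bOf≡1 {C} {t} t²+t<C = trans (bOf-as-⊖ C t) (sgn'[m⊖n]≡1 t²+t<C)

interpolate : ℤ → ℤ → ℤ → ℤ
interpolate a x y = (1ℤ ℤ.- a) ℤ.* x ℤ.+ a ℤ.* y

interpolate-0 : ∀ x y → interpolate 0ℤ x y ≡ x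
interpolate-0 x y =
  trans (cong₂ ℤ._+_ (ℤ.*-identityˡ x) (ℤ.*-zeroˡ y)) (ℤ.+-identityʳ x)

interpolate-1 : ∀ x y → interpolate 1ℤ x y ≡ y
interpolate-1 x y =
  trans (cong₂ ℤ._+_ (ℤ.*-zeroˡ x) (ℤ.*-identityˡ y)) (ℤ.+-identityˡ y)

mSol-aOf≡0 : ∀ {C t} → aOf C t ≡ 0ℤ → mSol C t ≡ + t
mSol-aOf≡0 {C} {t} a≡0 = trans (cong (λ a → interpolate a (+ t) y) a≡0) (interpolate-0 (+ t) y)
  where y = (+ t ℤ.+ 1ℤ) ℤ.* (+ t ℤ.+ 1ℤ ℤ.+ bOf C t) ℤ.- + C

nSol-aOf≡0 : ∀ {C t} → aOf C t ≡ 0ℤ → nSol C t ≡ + t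
nSol-aOf≡0 {C} {t} a≡0 = trans (cong (λ a → interpolate a (+ t) y) a≡0) (interpolate-0 (+ t) y)
  where y = + C ℤ.- + t ℤ.* (+ t ℤ.+ bOf C t)

+-difference : ∀ {m c x} → m + c ≡ x → + m ≡ + x ℤ.- + c
+-difference {m} {c} {x} m+c≡x = begin
  + m                        ≡⟨ add-sub (+ m) (+ c) ⟩
  + m ℤ.+ + c ℤ.- + c        ≡⟨ cong (ℤ._- + c) (sym (pos-+ m c)) ⟩
  + (m + c) ℤ.- + c          ≡⟨ cong (λ y → + y ℤ.- + c) m+c≡x ⟩
  + x ℤ.- + c                ∎
  where
  add-sub : ∀ y z → y ≡ y ℤ.+ z ℤ.- z
  add-sub = ℤ-Solver.solve-∀

mSol-aOf≡1 : ∀ {C t b m} → aOf C t ≡ 1ℤ → bOf C t ≡ + b →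
  m + C ≡ (t + 1) * (t + 1 + b) → + m ≡ mSol C t
mSol-aOf≡1 {C} {t} {b} {m} a≡1 b≡b m+C≡ = begin
  + m                                                ≡⟨ +-difference m+C≡ ⟩
  + ((t + 1) * (t + 1 + b)) ℤ.- + C                  ≡⟨ cong (ℤ._- + C) cast ⟩
  (+ t ℤ.+ 1ℤ) ℤ.* (+ t ℤ.+ 1ℤ ℤ.+ + b) ℤ.- + C       ≡⟨ interpolate-1 (+ t) _ ⟨
  interpolate 1ℤ (+ t) ((+ t ℤ.+ 1ℤ) ℤ.* (+ t ℤ.+ 1ℤ ℤ.+ + b) ℤ.- + C)
    ≡⟨ cong₂ (λ a b → interpolate a (+ t) ((+ t ℤ.+ 1ℤ) ℤ.* (+ t ℤ.+ 1ℤ ℤ.+ b) ℤ.- + C))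
             (sym a≡1) (sym b≡b) ⟩
  mSol C t                                           ∎
  where
  cast : + ((t + 1) * (t + 1 + b)) ≡ (+ t ℤ.+ 1ℤ) ℤ.* (+ t ℤ.+ 1ℤ ℤ.+ + b)
  cast = trans (pos-* (t + 1) (t + 1 + b))
    (cong₂ ℤ._*_ (pos-+ t 1) (trans (pos-+ (t + 1) b) (cong (ℤ._+ + b) (pos-+ t 1))))

nSol-aOf≡1 : ∀ {C t b n} → aOf C t ≡ 1ℤ → bOf C t ≡ + b →
  n + t * (t + b) ≡ C → + n ≡ nSol C t
nSol-aOf≡1 {C} {t} {b} {n} a≡1 b≡b n+t[t+b]≡C = begin
  + n                                     ≡⟨ +-difference n+t[t+b]≡C ⟩
  + C ℤ.- + (t * (t + b))                 ≡⟨ cong (λ x → + C ℤ.- x) cast ⟩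
  + C ℤ.- + t ℤ.* (+ t ℤ.+ + b)           ≡⟨ interpolate-1 (+ t) _ ⟨
  interpolate 1ℤ (+ t) (+ C ℤ.- + t ℤ.* (+ t ℤ.+ + b))
    ≡⟨ cong₂ (λ a b → interpolate a (+ t) (+ C ℤ.- + t ℤ.* (+ t ℤ.+ b))) (sym a≡1) (sym b≡b) ⟩
  nSol C t                                ∎
  where
  cast : + (t * (t + b)) ≡ + t ℤ.* (+ t ℤ.+ + b)
  cast = trans (pos-* t (t + b)) (cong (+ t ℤ.*_) (pos-+ t b))

closedForm-square : ∀ t → + t ≡ mSol (t * t) t × + t ≡ nSol (t * t) t
closedForm-square t = sym (mSol-aOf≡0 (aOf-square t)) , sym (nSol-aOf≡0 (aOf-square t))

closedForm-lower : ∀ n w → 0 < n →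
  let k = n + w in + (n + suc (w + w)) ≡ mSol (k * k + n) k × + n ≡ nSol (k * k + n) k
closedForm-lower n w 0<n =
  mSol-aOf≡1 {t = k} a≡1 b≡0 (m-identity n w) , nSol-aOf≡1 {t = k} a≡1 b≡0 (n-identity n w)
  where
  k = n + w
  a≡1 : aOf (k * k + n) k ≡ 1ℤ
  a≡1 = aOf≡1 {t = k} (m<m+n (k * k) 0<n)
  b≡0 : bOf (k * k + n) k ≡ 0ℤ
  b≡0 = bOf≡0 {t = k} (+-monoʳ-≤ (k * k) (m≤m+n n w))
  m-identity : ∀ n w → n + suc (w + w) + ((n + w) * (n + w) + n) ≡ (n + w + 1) * (n + w + 1 + 0)
  m-identity = ℕ-Solver.solve-∀
  n-identity : ∀ n w → n + (n + w) * ((n + w) + 0) ≡ (n + w) * (n + w) + n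
  n-identity = ℕ-Solver.solve-∀

closedForm-upper : ∀ p w →
  let k = p + w ; C = k * k + (k + suc p) in
  + (suc p + (w + w)) ≡ mSol C k × + suc p ≡ nSol C k
closedForm-upper p w =
  mSol-aOf≡1 {t = k} a≡1 b≡1 (m-identity p w) , nSol-aOf≡1 {t = k} a≡1 b≡1 (n-identity p w)
  where
  k = p + w
  C = k * k + (k + suc p)
  k²+k<C : k * k + k < C
  k²+k<C = +-monoʳ-< (k * k) (m<m+n k (s≤s z≤n))
  a≡1 : aOf C k ≡ 1ℤ
  a≡1 = aOf≡1 {t = k} (≤-<-trans (m≤m+n (k * k) k) k²+k<C)
  b≡1 : bOf C k ≡ 1ℤ
  b≡1 = bOf≡1 {t = k} k²+k<C
  m-identity : ∀ p w → suc p + (w + w) + ((p + w) * (p + w) + ((p + w) + suc p))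
                     ≡ (p + w + 1) * (p + w + 1 + 1)
  m-identity = ℕ-Solver.solve-∀
  n-identity : ∀ p w → suc p + (p + w) * ((p + w) + 1) ≡ (p + w) * (p + w) + ((p + w) + suc p)
  n-identity = ℕ-Solver.solve-∀

closedForm-inverts-F : ∀ {m n C t} → 0 < n → n ≤ m → F m n ≡ C → IsFloorSqrt t C →
  + m ≡ mSol C t × + n ≡ nSol C t
closedForm-inverts-F {n = n} 0<n@(s≤s {n = p} z≤n) n≤m Fmn≡C t-floor
  with m≤n⇒∃[o]m+o≡n n≤m
... | d , n+d≡m with parity d
... | odd w
  with refl ← n+d≡m
  with refl ← trans (sym Fmn≡C) (F-odd-gap n w)
  with refl ← floorSqrt-unique t-floor (floorSqrt-odd-gap n w)
  = closedForm-lower n w 0<n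
... | even zero
  with refl ← trans (sym (+-identityʳ n)) n+d≡m
  with refl ← trans (sym Fmn≡C) (F-diagonal n)
  with refl ← floorSqrt-unique t-floor (floorSqrt-square n)
  = closedForm-square n
... | even (suc v)
  with refl ← n+d≡m
  with refl ← trans (sym Fmn≡C) (F-even-gap p (suc v))
  with refl ← floorSqrt-unique t-floor (floorSqrt-even-gap p v)
  = closedForm-upper p (suc v)

F-surjective : ∀ {C t} → 0 < C → IsFloorSqrt t C → ∃₂ λ m n → 0 < n × n ≤ m × F m n ≡ C
F-surjective {t = t} 0<C t-floor with m≤n⇒∃[o]m+o≡n (IsFloorSqrt.lower t-floor)
... | r , refl with r ≤? t
F-surjective {t = zero}  () _ | zero , refl | _
F-surjective {t = suc p} _  _ | zero , refl | _ =
  suc p , suc p , s≤s z≤n , ≤-refl , trans (F-diagonal (suc p)) (sym (+-identityʳ _))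
F-surjective _ _ | suc q , refl | yes 1+q≤t with m≤n⇒∃[o]m+o≡n 1+q≤t
... | w , refl = suc q + suc (w + w) , suc q , s≤s z≤n , m≤m+n (suc q) _ , F-odd-gap (suc q) w
F-surjective {t = t} _ t-floor | suc q , refl | no 1+q≰t with m≤n⇒∃[o]m+o≡n (≤-pred (≰⇒> 1+q≰t))
... | u , refl with m≤n⇒∃[o]m+o≡n (+-cancelˡ-< t u t (floorSqrt-excess-≤ t-floor))
... | v , refl = suc u + (suc v + suc v) , suc u , s≤s z≤n , m≤m+n (suc u) _ ,
  trans (F-even-gap u (suc v)) (shift u v)
  where
  shift : ∀ u v → (u + suc v) * (u + suc v) + ((u + suc v) + suc u)
                ≡ (suc u + v) * (suc u + v) + suc ((suc u + v) + u)
  shift = ℕ-Solver.solve-∀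

theorem5 : (C : ℕ) → 1 ≤ C → (t : ℕ) → t * t ≤ C → C < suc t * suc t →
    Σ ℕ (λ m → Σ ℕ (λ n →
      (+ m ≡ mSol C t) × (+ n ≡ nSol C t) ×
      1 ≤ m × 1 ≤ n × n ≤ m × F m n ≡ C ×
      ((m' n' : ℕ) → 1 ≤ m' → 1 ≤ n' → n' ≤ m' → F m' n' ≡ C →
        (m' ≡ m) × (n' ≡ n))))
theorem5 C 1≤C t t²≤C C<[t+1]² with F-surjective {t = t} 1≤C (isFloorSqrt t²≤C C<[t+1]²)
... | m , n , 1≤n , n≤m , Fmn≡C =
  m , n , +m≡mSol , +n≡nSol , ≤-trans 1≤n n≤m , 1≤n , n≤m , Fmn≡C , unique
  where
  t-floor : IsFloorSqrt t C
  t-floor = isFloorSqrt t²≤C C<[t+1]²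
  +m≡mSol : + m ≡ mSol C t
  +m≡mSol = proj₁ (closedForm-inverts-F 1≤n n≤m Fmn≡C t-floor)
  +n≡nSol : + n ≡ nSol C t
  +n≡nSol = proj₂ (closedForm-inverts-F 1≤n n≤m Fmn≡C t-floor)
  unique : (m' n' : ℕ) → 1 ≤ m' → 1 ≤ n' → n' ≤ m' → F m' n' ≡ C → (m' ≡ m) × (n' ≡ n)
  unique m' n' _ 1≤n' n'≤m' Fm'n'≡C =
    let +m'≡mSol , +n'≡nSol = closedForm-inverts-F 1≤n' n'≤m' Fm'n'≡C t-floor
    in ℤ.+-injective (trans +m'≡mSol (sym +m≡mSol)) , ℤ.+-injective (trans +n'≡nSol (sym +n≡nSol))
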